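{- For each integer $k\ge 1$ let $H_{2^k}$ denote the Sylvester Hadamard matrix of order $2^k$, i.e. the Kronecker product $H_2\times\cdots\times H_2$ of $k$ copies of $H_2=\begin{bmatrix}1&1\\1&-1\end{bmatrix}$, and let $I_m$ denote the $m\times m$ identity matrix. Suppose that for all integers $n\ge 2$ and $m\ge 2$, $$\operatorname{per}\big((H_{2^n}\times I_{2^m})(I_{2^n}\times H_{2^m})\big)\ \ge\ \operatorname{per}(H_{2^n}\times I_{2^m})\,\operatorname{per}(I_{2^n}\times H_{2^m}).$$ Then $\operatorname{per}(H_{2^k})\neq 0$ for every $k>2$.
   Context: Here $A\times B$ denotes the Kronecker product of matrices. The permanent of an $N\times N$ matrix $A=[a_{ij}]$ is $\operatorname{per}(A)=\sum_{\sigma\in S_N}\prod_{i=1}^N a_{i,\sigma(i)}$, where $S_N$ is the symmetric group on $\{1,\dots,N\}$. -}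

module Defs where

open import Data.Nat using (ℕ; zero; suc; _^_) renaming (_*_ to _*ℕ_)
open import Data.Integer using (ℤ; +_; -_; _+_; _*_)
open import Data.Fin using (Fin; remQuot; _≟_)
open import Data.Fin.Properties using () renaming (_≟_ to _≟F_)
open import Data.List using (List; []; _∷_; map; concatMap; foldr; filter)
open import Data.List using () renaming (allFin to allFinL)
open import Data.Vec.Functional using () renaming (_∷_ to _∷ᶠ_)
open import Data.Bool using (Bool; true; false; _∨_; not; if_then_else_)
open import Data.Product using (_,_)
open import Relation.Nullary.Decidable using (⌊_⌋)

Mat : ℕ → Set
Mat N = Fin N → Fin N → ℤ

Σᶠ : (n : ℕ) → (Fin n → ℤ) → ℤ
Σᶠ n f = foldr _+_ (+ 0) (map f (allFinL n))

Πᶠ : (n : ℕ) → (Fin n → ℤ) → ℤ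
Πᶠ n f = foldr _*_ (+ 1) (map f (allFinL n))

_·ₘ_ : {N : ℕ} → Mat N → Mat N → Mat N
_·ₘ_ {N} A B i j = Σᶠ N (λ k → A i k * B k j)

-- Kronecker product: (A × B)[(i1,i2),(j1,j2)] = A[i1,j1] B[i2,j2],
-- with row/column index (i1,i2) ↦ i1 * b + i2 (Data.Fin.combine / remQuot).
_⊗_ : {a b : ℕ} → Mat a → Mat b → Mat (a *ℕ b)
_⊗_ {a} {b} A B i j with remQuot {a} b i | remQuot {a} b j
... | i₁ , i₂ | j₁ , j₂ = A i₁ j₁ * B i₂ j₂

idMat : (m : ℕ) → Mat m
idMat m i j = if ⌊ i ≟F j ⌋ then + 1 else + 0

H₂ : Mat 2
H₂ Fin.zero Fin.zero = + 1
H₂ Fin.zero (Fin.suc Fin.zero) = + 1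
H₂ (Fin.suc Fin.zero) Fin.zero = + 1
H₂ (Fin.suc Fin.zero) (Fin.suc Fin.zero) = - (+ 1)

-- Sylvester Hadamard matrix of order 2^k: Kronecker product of k copies of H₂
-- (k = 0 gives the 1×1 matrix [1]; only k ≥ 1 is used).
hadamard : (k : ℕ) → Mat (2 ^ k)
hadamard zero = λ _ _ → + 1
hadamard (suc k) = H₂ ⊗ hadamard k

allMaps : (n N : ℕ) → List (Fin n → Fin N)
allMaps zero N = (λ ()) ∷ []
allMaps (suc n) N = concatMap (λ f → map (λ x → x ∷ᶠ f) (allFinL N)) (allMaps n N)

allB : {A : Set} → (A → Bool) → List A → Bool
allB p = foldr (λ x b → p x Data.Bool.∧ b) true

-- σ : Fin N → Fin N is a permutation (injective self-map of a finite set)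
isPerm : {N : ℕ} → (Fin N → Fin N) → Bool
isPerm {N} σ = allB (λ i → allB (λ j → ⌊ i ≟F j ⌋ ∨ not ⌊ σ i ≟F σ j ⌋) (allFinL N)) (allFinL N)

Sym : (N : ℕ) → List (Fin N → Fin N)
Sym N = filter (λ σ → Data.Bool._≟_ (isPerm σ) true) (allMaps N N)

per : {N : ℕ} → Mat N → ℤ
per {N} A = foldr _+_ (+ 0) (map (λ σ → Πᶠ N (λ i → A i (σ i))) (Sym N))

-- Write H_k
-- for the Sylvester matrix of order 2^k (hadamard k).
--
-- Idea.  By the mixed product rule XY = H_n ⊗ H_m, which is H_{n+m} with
-- its rows and columns relabelled simultaneously; relabelling does not
-- change a permanent.
-- A Kronecker product with an identity matrix is, up to relabelling, block
-- diagonal, so per(H_n ⊗ I_{2^m}) = per(H_n)^(2^m) and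
-- per(I_{2^n} ⊗ H_m) = per(H_m)^(2^n).  With n = 2 the hypothesis becomes
--   per(H_{2+m}) ≥ 8^(2^m) · per(H_m)^4 ,
-- which is positive as soon as per(H_m) ≠ 0.  Strong induction on k, with
-- per(H_2) = 8 and per(H_3) = 384 computed by Laplace expansion, finishes.
module Submission where

open import Defs
open import Data.Nat using (ℕ; zero; suc; _^_; z≤n; s≤s)
  renaming (_+_ to _+ℕ_; _*_ to _*ℕ_; _≤_ to _≤ℕ_; _<_ to _<ℕ_)
import Data.Nat.Properties as ℕP
open import Data.Nat.Solver using (module +-*-Solver)
open import Data.Integer using (ℤ; +_; -[1+_]; _+_; _*_; _≤_; +≤+)
  renaming (_^_ to _^ℤ_)
import Data.Integer.Properties as ℤP
open import Data.Fin
  using (Fin; zero; suc; punchIn; _↑ˡ_; _↑ʳ_; splitAt; combine; remQuot; cast; toℕ)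
open import Data.Fin.Properties
  using ( suc-injective; 0≢1+n; punchInᵢ≢i; punchIn-injective
        ; ↑ˡ-injective; ↑ʳ-injective; splitAt-↑ˡ; splitAt-↑ʳ; splitAt⁻¹-↑ˡ; splitAt⁻¹-↑ʳ
        ; remQuot-combine; combine-surjective; toℕ-combine; toℕ-cast; toℕ-injective )
  renaming (_≟_ to _≟F_)
open import Data.Fin.Permutation as Perm using (Permutation; _⟨$⟩ʳ_; _⟨$⟩ˡ_)
open import Data.List using (List; []; _∷_; map; foldr; tabulate; concatMap; filter; _++_)
  renaming (allFin to allFinL)
open import Data.List.Properties using (map-tabulate; map-++; map-cong; map-∘)
open import Data.Vec.Functional using (insertAt) renaming (_∷_ to _∷ᶠ_; _++_ to _++ᶠ_)
open import Data.Vec.Functional.Properties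
  using (lookup-++ˡ; lookup-++ʳ; ++-cong; insertAt-lookup; insertAt-punchIn)
open import Data.Bool using (Bool; true; false; if_then_else_; _∨_; not)
import Data.Bool as Bool
open import Data.Sum using (_⊎_; inj₁; inj₂)
open import Data.Product using (_,_; Σ; ∃; _×_; proj₁; proj₂)
open import Data.Empty using (⊥; ⊥-elim)
open import Function using (_∘_; id)
open import Relation.Binary.PropositionalEquality
open import Relation.Nullary using (¬_; Dec; yes; no)
open import Relation.Nullary.Decidable using (⌊_⌋)

import Algebra.Properties.CommutativeMonoid.Sum as CMonoidSum
import Algebra.Properties.Semiring.Sum as SemiringSum
import Algebra.Properties.CommutativeSemigroup as CSemigroupProps

private
  module Sum  = CMonoidSum ℤP.+-0-commutativeMonoid
  module Prod = CMonoidSum ℤP.*-1-commutativeMonoid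
  module SSum = SemiringSum ℤP.+-*-semiring
open CSemigroupProps ℤP.*-commutativeSemigroup using (interchange; x∙yz≈y∙xz)

∑ : (n : ℕ) → (Fin n → ℤ) → ℤ
∑ n f = Sum.sum f

∏ : (n : ℕ) → (Fin n → ℤ) → ℤ
∏ n f = Prod.sum f

sumList : List ℤ → ℤ
sumList = foldr _+_ (+ 0)

sumList-tabulate : ∀ n (f : Fin n → ℤ) → sumList (tabulate f) ≡ ∑ n f
sumList-tabulate zero    f = refl
sumList-tabulate (suc n) f = cong (_+_ (f zero)) (sumList-tabulate n (f ∘ suc))

prodList-tabulate : ∀ n (f : Fin n → ℤ) → foldr _*_ (+ 1) (tabulate f) ≡ ∏ n f
prodList-tabulate zero    f = refl
prodList-tabulate (suc n) f = cong (f zero *_) (prodList-tabulate n (f ∘ suc))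

Σᶠ≡∑ : ∀ n f → Σᶠ n f ≡ ∑ n f
Σᶠ≡∑ n f = trans (cong sumList (map-tabulate id f)) (sumList-tabulate n f)

Πᶠ≡∏ : ∀ n f → Πᶠ n f ≡ ∏ n f
Πᶠ≡∏ n f = trans (cong (foldr _*_ (+ 1)) (map-tabulate id f)) (prodList-tabulate n f)

∑-cong : ∀ n {f g : Fin n → ℤ} → (∀ i → f i ≡ g i) → ∑ n f ≡ ∑ n g
∑-cong n = Sum.sum-cong-≗

∏-cong : ∀ n {f g : Fin n → ℤ} → (∀ i → f i ≡ g i) → ∏ n f ≡ ∏ n g
∏-cong n = Prod.sum-cong-≗

∑-zero : ∀ n {f : Fin n → ℤ} → (∀ i → f i ≡ + 0) → ∑ n f ≡ + 0
∑-zero n {f} f≡0 = trans (∑-cong n f≡0) (Sum.sum-replicate-zero n)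

∑-*ˡ : ∀ n (c : ℤ) (f : Fin n → ℤ) → ∑ n (λ i → c * f i) ≡ c * ∑ n f
∑-*ˡ n c f = sym (SSum.*-distribˡ-sum c f)

∑-comm : ∀ m n (f : Fin m → Fin n → ℤ) →
  ∑ m (λ i → ∑ n (f i)) ≡ ∑ n (λ j → ∑ m (λ i → f i j))
∑-comm m n f = Sum.∑-comm f

∑-permute : ∀ n (f : Fin n → ℤ) (π : Permutation n n) → ∑ n (λ i → f (π ⟨$⟩ʳ i)) ≡ ∑ n f
∑-permute n f π = sym (Sum.sum-permute f π)

∏-permute : ∀ n (f : Fin n → ℤ) (π : Permutation n n) → ∏ n (λ i → f (π ⟨$⟩ʳ i)) ≡ ∏ n f
∏-permute n f π = sym (Prod.sum-permute f π)

∏-zero : ∀ n (f : Fin n → ℤ) (k : Fin n) → f k ≡ + 0 → ∏ n f ≡ + 0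
∏-zero (suc n) f zero    fk≡0 = cong (_* ∏ n (f ∘ suc)) fk≡0
∏-zero (suc n) f (suc k) fk≡0 =
  trans (cong (f zero *_) (∏-zero n (f ∘ suc) k fk≡0)) (ℤP.*-zeroʳ (f zero))

∑-punchIn : ∀ n (f : Fin (suc n) → ℤ) (v : Fin (suc n)) →
  ∑ (suc n) f ≡ f v + ∑ n (λ j → f (punchIn v j))
∑-punchIn n f v = Sum.sum-remove {i = v} f

∑-split : ∀ b c (f : Fin (b +ℕ c) → ℤ) →
  ∑ (b +ℕ c) f ≡ ∑ b (λ i → f (i ↑ˡ c)) + ∑ c (λ i → f (b ↑ʳ i))
∑-split zero    c f = sym (ℤP.+-identityˡ _)
∑-split (suc b) c f =
  trans (cong (_+_ (f zero)) (∑-split b c (f ∘ suc))) (sym (ℤP.+-assoc (f zero) _ _))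

∏-split : ∀ b c (f : Fin (b +ℕ c) → ℤ) →
  ∏ (b +ℕ c) f ≡ ∏ b (λ i → f (i ↑ˡ c)) * ∏ c (λ i → f (b ↑ʳ i))
∏-split zero    c f = sym (ℤP.*-identityˡ _)
∏-split (suc b) c f =
  trans (cong (f zero *_) (∏-split b c (f ∘ suc))) (sym (ℤP.*-assoc (f zero) _ _))

∑-right : ∀ b c (f : Fin (b +ℕ c) → ℤ) → (∀ i → f (i ↑ˡ c) ≡ + 0) →
  ∑ (b +ℕ c) f ≡ ∑ c (λ i → f (b ↑ʳ i))
∑-right b c f left≡0 = begin
  ∑ (b +ℕ c) f                                       ≡⟨ ∑-split b c f ⟩
  ∑ b (λ i → f (i ↑ˡ c)) + ∑ c (λ i → f (b ↑ʳ i))  ≡⟨ cong (_+ ∑ c (λ i → f (b ↑ʳ i))) (∑-zero b left≡0) ⟩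
  + 0 + ∑ c (λ i → f (b ↑ʳ i))                       ≡⟨ ℤP.+-identityˡ _ ⟩
  ∑ c (λ i → f (b ↑ʳ i))                             ∎
  where open ≡-Reasoning

∑-left : ∀ b c (f : Fin (b +ℕ c) → ℤ) → (∀ i → f (b ↑ʳ i) ≡ + 0) →
  ∑ (b +ℕ c) f ≡ ∑ b (λ i → f (i ↑ˡ c))
∑-left b c f right≡0 = begin
  ∑ (b +ℕ c) f                                       ≡⟨ ∑-split b c f ⟩
  ∑ b (λ i → f (i ↑ˡ c)) + ∑ c (λ i → f (b ↑ʳ i))  ≡⟨ cong (_+_ (∑ b (λ i → f (i ↑ˡ c)))) (∑-zero c right≡0) ⟩
  ∑ b (λ i → f (i ↑ˡ c)) + + 0                       ≡⟨ ℤP.+-identityʳ _ ⟩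
  ∑ b (λ i → f (i ↑ˡ c))                             ∎
  where open ≡-Reasoning

∑-single : ∀ n (f : Fin n → ℤ) (k : Fin n) → (∀ i → ¬ i ≡ k → f i ≡ + 0) → ∑ n f ≡ f k
∑-single (suc n) f k f≡0 = begin
    ∑ (suc n) f                        ≡⟨ ∑-punchIn n f k ⟩
    f k + ∑ n (λ j → f (punchIn k j))  ≡⟨ cong (_+_ (f k)) (∑-zero n (λ j → f≡0 _ (punchInᵢ≢i k j))) ⟩
    f k + + 0                          ≡⟨ ℤP.+-identityʳ (f k) ⟩
    f k                                ∎
  where open ≡-Reasoning

-- Sums over all maps Fin n → Fin N

∑maps : (n N : ℕ) → ((Fin n → Fin N) → ℤ) → ℤ
∑maps zero    N G = G (λ ())
∑maps (suc n) N G = ∑ N (λ v → ∑maps n N (λ f → G (v ∷ᶠ f)))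

-- Equality of maps is not extensional, so the lemmas below ask that the
-- summand respect pointwise equality.
Extensional : ∀ {n N} → ((Fin n → Fin N) → ℤ) → Set
Extensional G = ∀ f g → (∀ i → f i ≡ g i) → G f ≡ G g

∷-cong : ∀ {n N} (v : Fin N) (f g : Fin n → Fin N) → (∀ i → f i ≡ g i) →
  ∀ i → (v ∷ᶠ f) i ≡ (v ∷ᶠ g) i
∷-cong v f g f≗g zero    = refl
∷-cong v f g f≗g (suc i) = f≗g i

Extensional-∷ : ∀ {n N} {G : (Fin (suc n) → Fin N) → ℤ} → Extensional G →
  (v : Fin N) → Extensional (λ f → G (v ∷ᶠ f))
Extensional-∷ ext v f g f≗g = ext _ _ (∷-cong v f g f≗g)

∑maps-cong : ∀ n N {G H : (Fin n → Fin N) → ℤ} → (∀ f → G f ≡ H f) →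
  ∑maps n N G ≡ ∑maps n N H
∑maps-cong zero    N G≡H = G≡H _
∑maps-cong (suc n) N G≡H = ∑-cong N (λ v → ∑maps-cong n N (λ f → G≡H (v ∷ᶠ f)))

∑maps-zero : ∀ n N {G : (Fin n → Fin N) → ℤ} → (∀ f → G f ≡ + 0) → ∑maps n N G ≡ + 0
∑maps-zero zero    N G≡0 = G≡0 _
∑maps-zero (suc n) N G≡0 = ∑-zero N (λ v → ∑maps-zero n N (λ f → G≡0 (v ∷ᶠ f)))

∑maps-*ˡ : ∀ n N (c : ℤ) (G : (Fin n → Fin N) → ℤ) →
  ∑maps n N (λ f → c * G f) ≡ c * ∑maps n N G
∑maps-*ˡ zero    N c G = refl
∑maps-*ˡ (suc n) N c G =
  trans (∑-cong N (λ v → ∑maps-*ˡ n N c (λ f → G (v ∷ᶠ f)))) (∑-*ˡ N c _)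

∑maps-*ʳ : ∀ n N (c : ℤ) (G : (Fin n → Fin N) → ℤ) →
  ∑maps n N (λ f → G f * c) ≡ ∑maps n N G * c
∑maps-*ʳ n N c G = begin
  ∑maps n N (λ f → G f * c)  ≡⟨ ∑maps-cong n N (λ f → ℤP.*-comm (G f) c) ⟩
  ∑maps n N (λ f → c * G f)  ≡⟨ ∑maps-*ˡ n N c G ⟩
  c * ∑maps n N G            ≡⟨ ℤP.*-comm c _ ⟩
  ∑maps n N G * c            ∎
  where open ≡-Reasoning

∑maps-∑ : ∀ n N K (H : Fin K → (Fin n → Fin N) → ℤ) →
  ∑maps n N (λ f → ∑ K (λ x → H x f)) ≡ ∑ K (λ x → ∑maps n N (H x))
∑maps-∑ zero    N K H = refl
∑maps-∑ (suc n) N K H =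
  trans (∑-cong N (λ v → ∑maps-∑ n N K (λ x f → H x (v ∷ᶠ f))))
        (∑-comm N K (λ v x → ∑maps n N (λ f → H x (v ∷ᶠ f))))

∑maps-permute-values : ∀ n N (π : Permutation N N) (G : (Fin n → Fin N) → ℤ) → Extensional G →
  ∑maps n N (λ f → G (λ i → π ⟨$⟩ʳ f i)) ≡ ∑maps n N G
∑maps-permute-values zero    N π G ext = ext _ _ (λ ())
∑maps-permute-values (suc n) N π G ext = begin
    ∑ N (λ v → ∑maps n N (λ f → G (λ i → π ⟨$⟩ʳ (v ∷ᶠ f) i)))
  ≡⟨ ∑-cong N (λ v → ∑maps-cong n N (λ f → ext _ _ (λ { zero → refl ; (suc i) → refl }))) ⟩
    ∑ N (λ v → ∑maps n N (λ f → G ((π ⟨$⟩ʳ v) ∷ᶠ (λ i → π ⟨$⟩ʳ f i))))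
  ≡⟨ ∑-cong N (λ v → ∑maps-permute-values n N π (λ g → G ((π ⟨$⟩ʳ v) ∷ᶠ g))
                                             (Extensional-∷ ext _)) ⟩
    ∑ N (λ v → ∑maps n N (λ g → G ((π ⟨$⟩ʳ v) ∷ᶠ g)))
  ≡⟨ ∑-permute N (λ v → ∑maps n N (λ g → G (v ∷ᶠ g))) π ⟩
    ∑ N (λ v → ∑maps n N (λ g → G (v ∷ᶠ g)))
  ∎ where open ≡-Reasoning

∑maps-restrict : ∀ n N K (e : Fin K → Fin N) (Bad : Fin N → Set) →
  (∀ g → (∀ x → Bad x → g x ≡ + 0) → ∑ N g ≡ ∑ K (λ w → g (e w))) →
  (G : (Fin n → Fin N) → ℤ) → Extensional G → (∀ f i → Bad (f i) → G f ≡ + 0) →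
  ∑maps n N G ≡ ∑maps n K (λ f → G (λ i → e (f i)))
∑maps-restrict zero    N K e Bad restrict G ext vanish = ext _ _ (λ ())
∑maps-restrict (suc n) N K e Bad restrict G ext vanish = begin
    ∑ N (λ v → ∑maps n N (λ f → G (v ∷ᶠ f)))
  ≡⟨ ∑-cong N (λ v → ∑maps-restrict n N K e Bad restrict (λ f → G (v ∷ᶠ f))
       (Extensional-∷ ext v) (λ f i → vanish (v ∷ᶠ f) (suc i))) ⟩
    ∑ N (λ v → ∑maps n K (λ f → G (v ∷ᶠ (λ i → e (f i)))))
  ≡⟨ restrict _ (λ x bad → ∑maps-zero n K (λ f → vanish _ zero bad)) ⟩
    ∑ K (λ w → ∑maps n K (λ f → G (e w ∷ᶠ (λ i → e (f i)))))
  ≡⟨ ∑-cong K (λ w → ∑maps-cong n K (λ f → ext _ _ (λ { zero → refl ; (suc i) → refl }))) ⟩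
    ∑ K (λ w → ∑maps n K (λ f → G (λ i → e ((w ∷ᶠ f) i))))
  ∎ where open ≡-Reasoning

∑maps-split : ∀ b c N (G : (Fin (b +ℕ c) → Fin N) → ℤ) → Extensional G →
  ∑maps (b +ℕ c) N G ≡ ∑maps b N (λ y → ∑maps c N (λ z → G (y ++ᶠ z)))
∑maps-split zero    c N G ext = ∑maps-cong c N (λ z → ext _ _ (λ i → refl))
∑maps-split (suc b) c N G ext = ∑-cong N (λ v →
  trans (∑maps-split b c N (λ f → G (v ∷ᶠ f)) (Extensional-∷ ext v))
        (∑maps-cong b N (λ y → ∑maps-cong c N (λ z → ext _ _ (∷-++ v y z)))))
  where
  ∷-++ : ∀ v (y : Fin b → Fin N) (z : Fin c → Fin N) i →
    (v ∷ᶠ (y ++ᶠ z)) i ≡ ((v ∷ᶠ y) ++ᶠ z) i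
  ∷-++ v y z zero = refl
  ∷-++ v y z (suc i) with splitAt b i
  ... | inj₁ _ = refl
  ... | inj₂ _ = refl

∑maps-insertAt : ∀ n N (k : Fin (suc n)) (G : (Fin (suc n) → Fin N) → ℤ) → Extensional G →
  ∑maps (suc n) N G ≡ ∑ N (λ v → ∑maps n N (λ f → G (insertAt f k v)))
∑maps-insertAt n N zero G ext =
  ∑-cong N (λ v → ∑maps-cong n N (λ f → ext _ _ (λ { zero → refl ; (suc i) → refl })))
∑maps-insertAt (suc n) N (suc k) G ext = begin
    ∑ N (λ u → ∑maps (suc n) N (λ g → G (u ∷ᶠ g)))
  ≡⟨ ∑-cong N (λ u → ∑maps-insertAt n N k (λ g → G (u ∷ᶠ g)) (Extensional-∷ ext u)) ⟩
    ∑ N (λ u → ∑ N (λ v → ∑maps n N (λ f → G (u ∷ᶠ insertAt f k v))))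
  ≡⟨ ∑-comm N N _ ⟩
    ∑ N (λ v → ∑ N (λ u → ∑maps n N (λ f → G (u ∷ᶠ insertAt f k v))))
  ≡⟨ ∑-cong N (λ v → ∑-cong N (λ u → ∑maps-cong n N (λ f →
       ext _ _ (λ { zero → refl ; (suc i) → refl })))) ⟩
    ∑ N (λ v → ∑ N (λ u → ∑maps n N (λ f → G (insertAt (u ∷ᶠ f) (suc k) v))))
  ∎ where open ≡-Reasoning

∑maps-permute-domain : ∀ n N (ρ : Permutation n n) (G : (Fin n → Fin N) → ℤ) → Extensional G →
  ∑maps n N (λ f → G (λ i → f (ρ ⟨$⟩ʳ i))) ≡ ∑maps n N G
∑maps-permute-domain zero    N ρ G ext = ext _ _ (λ ())
∑maps-permute-domain (suc n) N ρ G ext = begin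
    ∑maps (suc n) N (λ f → G (λ i → f (ρ ⟨$⟩ʳ i)))
  ≡⟨ ∑maps-insertAt n N k _ (λ f g f≗g → ext _ _ (λ i → f≗g (ρ ⟨$⟩ʳ i))) ⟩
    ∑ N (λ v → ∑maps n N (λ f → G (λ i → insertAt f k v (ρ ⟨$⟩ʳ i))))
  ≡⟨ ∑-cong N (λ v → ∑maps-cong n N (λ f → ext _ _ (insert-permute v f))) ⟩
    ∑ N (λ v → ∑maps n N (λ f → G (v ∷ᶠ (λ j → f (ρ′ ⟨$⟩ʳ j)))))
  ≡⟨ ∑-cong N (λ v → ∑maps-permute-domain n N ρ′ (λ g → G (v ∷ᶠ g)) (Extensional-∷ ext v)) ⟩
    ∑ N (λ v → ∑maps n N (λ g → G (v ∷ᶠ g)))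
  ∎
  where
  open ≡-Reasoning
  k  = ρ ⟨$⟩ʳ zero
  ρ′ = Perm.remove zero ρ
  insert-permute : ∀ v (f : Fin n → Fin N) i →
    insertAt f k v (ρ ⟨$⟩ʳ i) ≡ (v ∷ᶠ (λ j → f (ρ′ ⟨$⟩ʳ j))) i
  insert-permute v f zero    = insertAt-lookup f k v
  insert-permute v f (suc j) =
    trans (cong (insertAt f k v) (Perm.punchIn-permute ρ zero j)) (insertAt-punchIn f k v _)

sumList-++ : ∀ xs ys → sumList (xs ++ ys) ≡ sumList xs + sumList ys
sumList-++ []       ys = sym (ℤP.+-identityˡ _)
sumList-++ (x ∷ xs) ys = trans (cong (_+_ (x)) (sumList-++ xs ys)) (sym (ℤP.+-assoc x _ _))

sumList-concatMap : ∀ {A C : Set} (G : C → ℤ) (h : A → List C) (L : List A) →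
  sumList (map G (concatMap h L)) ≡ sumList (map (λ a → sumList (map G (h a))) L)
sumList-concatMap G h []      = refl
sumList-concatMap G h (a ∷ L) =
  trans (cong sumList (map-++ G (h a) (concatMap h L)))
    (trans (sumList-++ (map G (h a)) _) (cong (_+_ (sumList (map G (h a)))) (sumList-concatMap G h L)))

sumList-allMaps : ∀ n N (G : (Fin n → Fin N) → ℤ) → Extensional G →
  sumList (map G (allMaps n N)) ≡ ∑maps n N G
sumList-allMaps zero    N G ext = trans (ℤP.+-identityʳ _) (ext _ _ (λ ()))
sumList-allMaps (suc n) N G ext = begin
    sumList (map G (allMaps (suc n) N))
  ≡⟨ sumList-concatMap G (λ f → map (λ x → x ∷ᶠ f) (allFinL N)) (allMaps n N) ⟩
    sumList (map (λ f → sumList (map G (map (λ x → x ∷ᶠ f) (allFinL N)))) (allMaps n N))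
  ≡⟨ cong sumList (map-cong first-value (allMaps n N)) ⟩
    sumList (map (λ f → ∑ N (λ x → G (x ∷ᶠ f))) (allMaps n N))
  ≡⟨ sumList-allMaps n N _ (λ f g f≗g → ∑-cong N (λ x → ext _ _ (∷-cong x f g f≗g))) ⟩
    ∑maps n N (λ f → ∑ N (λ x → G (x ∷ᶠ f)))
  ≡⟨ ∑maps-∑ n N N (λ x f → G (x ∷ᶠ f)) ⟩
    ∑maps (suc n) N G
  ∎
  where
  open ≡-Reasoning
  first-value : ∀ f → sumList (map G (map (λ x → x ∷ᶠ f) (allFinL N))) ≡ ∑ N (λ x → G (x ∷ᶠ f))
  first-value f = trans (cong sumList (sym (map-∘ (allFinL N))))
    (trans (cong sumList (map-tabulate id (λ x → G (x ∷ᶠ f)))) (sumList-tabulate N _))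

-- Injective maps and their indicator

-- A self-map of Fin n is a permutation exactly when it is injective.
IsInjective : ∀ {n N} → (Fin n → Fin N) → Set
IsInjective f = ∀ i j → f i ≡ f j → i ≡ j

allB-tabulate : ∀ {A : Set} n (p : A → Bool) (g : Fin n → A) →
  allB p (tabulate g) ≡ true → ∀ i → p (g i) ≡ true
allB-tabulate (suc n) p g all zero    with p (g zero)
... | true = refl
allB-tabulate (suc n) p g all (suc i) with p (g zero)
... | true = allB-tabulate n p (g ∘ suc) all i

allB-intro : ∀ {A : Set} (p : A → Bool) (L : List A) → (∀ x → p x ≡ true) → allB p L ≡ true
allB-intro p []      all = refl
allB-intro p (x ∷ L) all rewrite all x = allB-intro p L all

isPerm-sound : ∀ {n} (f : Fin n → Fin n) → isPerm f ≡ true → IsInjective f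
isPerm-sound {n} f ok i j fi≡fj with i ≟F j
... | yes i≡j = i≡j
... | no  i≢j = ⊥-elim (separated (allB-tabulate n _ id (allB-tabulate n _ id ok i) j))
  where
  separated : ⌊ i ≟F j ⌋ ∨ not ⌊ f i ≟F f j ⌋ ≡ true → ⊥
  separated test with i ≟F j | f i ≟F f j
  ... | yes i≡j | _        = i≢j i≡j
  separated ()     | no _    | yes _
  ... | no _    | no fi≢fj = fi≢fj fi≡fj

isPerm-complete : ∀ {n} (f : Fin n → Fin n) → IsInjective f → isPerm f ≡ true
isPerm-complete {n} f inj = allB-intro _ (allFinL n) (λ i → allB-intro _ (allFinL n) (separated i))
  where
  separated : ∀ i j → ⌊ i ≟F j ⌋ ∨ not ⌊ f i ≟F f j ⌋ ≡ true
  separated i j with i ≟F j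
  ... | yes _ = refl
  ... | no i≢j with f i ≟F f j
  ...   | yes fi≡fj = ⊥-elim (i≢j (inj i j fi≡fj))
  ...   | no _      = refl

χ : ∀ {n} → (Fin n → Fin n) → ℤ
χ σ = if isPerm σ then + 1 else + 0

χ-injective : ∀ {n} (σ : Fin n → Fin n) → IsInjective σ → χ σ ≡ + 1
χ-injective σ inj rewrite isPerm-complete σ inj = refl

χ-noninjective : ∀ {n} (σ : Fin n → Fin n) → ¬ IsInjective σ → χ σ ≡ + 0
χ-noninjective σ ¬inj with isPerm σ in ok
... | true  = ⊥-elim (¬inj (isPerm-sound σ ok))
... | false = refl

injective? : ∀ {n} (σ : Fin n → Fin n) → Dec (IsInjective σ)
injective? σ with isPerm σ in ok
... | true  = yes (isPerm-sound σ ok)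
... | false = no (λ inj → true≢false (trans (sym (isPerm-complete σ inj)) ok))
  where
  true≢false : true ≡ false → ⊥
  true≢false ()

χ-cong : ∀ {n m} (f : Fin n → Fin n) (g : Fin m → Fin m) →
  (IsInjective f → IsInjective g) → (IsInjective g → IsInjective f) → χ f ≡ χ g
χ-cong f g f⇒g g⇒f with injective? f
... | yes inj = trans (χ-injective f inj) (sym (χ-injective g (f⇒g inj)))
... | no ¬inj = trans (χ-noninjective f ¬inj) (sym (χ-noninjective g (¬inj ∘ g⇒f)))

χ-product : ∀ {n a b} (f : Fin n → Fin n) (y : Fin a → Fin a) (z : Fin b → Fin b) →
  (IsInjective f → IsInjective y × IsInjective z) →
  (IsInjective y → IsInjective z → IsInjective f) → χ f ≡ χ y * χ z
χ-product f y z split join with injective? y | injective? z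
... | yes iy | yes iz rewrite χ-injective y iy | χ-injective z iz = χ-injective f (join iy iz)
... | no ¬iy | _      rewrite χ-noninjective y ¬iy = χ-noninjective f (¬iy ∘ proj₁ ∘ split)
... | yes iy | no ¬iz rewrite χ-noninjective z ¬iz =
  trans (χ-noninjective f (¬iz ∘ proj₂ ∘ split)) (sym (ℤP.*-zeroʳ (χ y)))

χ-ext : ∀ {n} (f g : Fin n → Fin n) → (∀ i → f i ≡ g i) → χ f ≡ χ g
χ-ext f g f≗g = χ-cong f g
  (λ inj i j gi≡gj → inj i j (trans (f≗g i) (trans gi≡gj (sym (f≗g j)))))
  (λ inj i j fi≡fj → inj i j (trans (sym (f≗g i)) (trans fi≡fj (f≗g j))))

-- The permanent as a sum over all maps

per-term : ∀ {N} → Mat N → (Fin N → Fin N) → ℤ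
per-term {N} A σ = χ σ * ∏ N (λ i → A i (σ i))

per′ : ∀ {N} → Mat N → ℤ
per′ {N} A = ∑maps N N (per-term A)

per-term-ext : ∀ {N} (A : Mat N) → Extensional (per-term A)
per-term-ext {N} A f g f≗g = cong₂ _*_ (χ-ext f g f≗g) (∏-cong N (λ i → cong (A i) (f≗g i)))

sumList-filter : ∀ {A : Set} (F : A → ℤ) (p : A → Bool) (L : List A) →
  sumList (map F (filter (λ x → p x Bool.≟ true) L)) ≡ sumList (map (λ x → if p x then F x else + 0) L)
sumList-filter F p []      = refl
sumList-filter F p (x ∷ L) with p x
... | true  = cong (_+_ (F x)) (sumList-filter F p L)
... | false = trans (sumList-filter F p L) (sym (ℤP.+-identityˡ _))

per≡per′ : ∀ {N} (A : Mat N) → per A ≡ per′ A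
per≡per′ {N} A =
  trans (sumList-filter F isPerm (allMaps N N))
    (trans (cong sumList (map-cong filtered≡term (allMaps N N)))
      (sumList-allMaps N N _ (per-term-ext A)))
  where
  F : (Fin N → Fin N) → ℤ
  F σ = Πᶠ N (λ i → A i (σ i))
  filtered≡term : ∀ σ → (if isPerm σ then F σ else + 0) ≡ per-term A σ
  filtered≡term σ with isPerm σ
  ... | true  = trans (Πᶠ≡∏ N _) (sym (ℤP.*-identityˡ _))
  ... | false = refl

-- Invariance properties of the permanent

per′-cong : ∀ {N} (A B : Mat N) → (∀ i j → A i j ≡ B i j) → per′ A ≡ per′ B
per′-cong {N} A B A≡B = ∑maps-cong N N (λ σ → cong (χ σ *_) (∏-cong N (λ i → A≡B i (σ i))))

-- Relabelling rows and columns by the same permutation: the sum over σ is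
-- reindexed by σ ↦ ρ⁻¹ ∘ σ ∘ ρ.
per′-relabel : ∀ {N} (ρ : Permutation N N) (M : Mat N) →
  per′ (λ i j → M (ρ ⟨$⟩ʳ i) (ρ ⟨$⟩ʳ j)) ≡ per′ M
per′-relabel {N} ρ M = sym (begin
    ∑maps N N (per-term M)
  ≡⟨ sym (∑maps-permute-values N N ρ (per-term M) (per-term-ext M)) ⟩
    ∑maps N N G
  ≡⟨ sym (∑maps-permute-domain N N ρ⁻ G G-ext) ⟩
    ∑maps N N (λ f → G (λ i → f (ρ⁻ ⟨$⟩ʳ i)))
  ≡⟨ ∑maps-cong N N conjugate ⟩
    ∑maps N N (λ σ → χ σ * ∏ N (λ i → M (r i) (r (σ i))))
  ∎)
  where
  open ≡-Reasoning
  r  = ρ ⟨$⟩ʳ_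
  l  = ρ ⟨$⟩ˡ_
  ρ⁻ = Perm.flip ρ
  G : (Fin N → Fin N) → ℤ
  G g = per-term M (λ i → r (g i))
  G-ext : Extensional G
  G-ext f g f≗g = per-term-ext M _ _ (λ i → cong r (f≗g i))
  r-inj : ∀ {i j} → r i ≡ r j → i ≡ j
  r-inj {i} {j} e = trans (sym (Perm.inverseˡ ρ)) (trans (cong l e) (Perm.inverseˡ ρ))
  l-inj : ∀ {i j} → l i ≡ l j → i ≡ j
  l-inj {i} {j} e = trans (sym (Perm.inverseʳ ρ)) (trans (cong r e) (Perm.inverseʳ ρ))
  conjugate : ∀ f → G (λ i → f (ρ⁻ ⟨$⟩ʳ i)) ≡ χ f * ∏ N (λ i → M (r i) (r (f i)))
  conjugate f = cong₂ _*_
    (χ-cong _ f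
      (λ inj i j e → r-inj (inj (r i) (r j)
        (cong r (trans (cong f (Perm.inverseˡ ρ)) (trans e (cong f (sym (Perm.inverseˡ ρ))))))))
      (λ inj i j e → l-inj (inj (l i) (l j) (r-inj e))))
    (trans (sym (∏-permute N (λ i → M i (r (f (ρ⁻ ⟨$⟩ʳ i)))) ρ))
           (∏-cong N (λ i → cong (λ x → M (r i) (r (f x))) (Perm.inverseˡ ρ))))

per′-relabel-cast : ∀ {N N′} → N ≡ N′ → (τ : Permutation N N′) (M : Mat N′) →
  per′ (λ i j → M (τ ⟨$⟩ʳ i) (τ ⟨$⟩ʳ j)) ≡ per′ M
per′-relabel-cast refl τ M = per′-relabel τ M

module _ {b c : ℕ} where
  splitAt-view : ∀ (k : Fin (b +ℕ c)) → (∃ λ i → k ≡ i ↑ˡ c) ⊎ (∃ λ i → k ≡ b ↑ʳ i)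
  splitAt-view k with splitAt b k in eq
  ... | inj₁ i = inj₁ (i , sym (splitAt⁻¹-↑ˡ eq))
  ... | inj₂ i = inj₂ (i , sym (splitAt⁻¹-↑ʳ eq))

  ↑ˡ≢↑ʳ : ∀ (i : Fin b) (j : Fin c) → i ↑ˡ c ≡ b ↑ʳ j → ⊥
  ↑ˡ≢↑ʳ i j e with trans (sym (splitAt-↑ˡ b i c)) (trans (cong (splitAt b) e) (splitAt-↑ʳ b c j))
  ... | ()

χ-blockMap : ∀ {b c} (y : Fin b → Fin b) (z : Fin c → Fin c) →
  χ ((λ i → y i ↑ˡ c) ++ᶠ (λ i → b ↑ʳ z i)) ≡ χ y * χ z
χ-blockMap {b} {c} y z = χ-product f y z restrict glue
  where
  f : Fin (b +ℕ c) → Fin (b +ℕ c)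
  f = (λ i → y i ↑ˡ c) ++ᶠ (λ i → b ↑ʳ z i)
  f-left : ∀ i → f (i ↑ˡ c) ≡ y i ↑ˡ c
  f-left = lookup-++ˡ (λ i → y i ↑ˡ c) (λ i → b ↑ʳ z i)
  f-right : ∀ i → f (b ↑ʳ i) ≡ b ↑ʳ z i
  f-right = lookup-++ʳ (λ i → y i ↑ˡ c) (λ i → b ↑ʳ z i)
  restrict : IsInjective f → IsInjective y × IsInjective z
  restrict inj =
      (λ i j e → ↑ˡ-injective c i j (inj _ _ (trans (f-left i) (trans (cong (_↑ˡ c) e) (sym (f-left j))))))
    , (λ i j e → ↑ʳ-injective b i j (inj _ _ (trans (f-right i) (trans (cong (b ↑ʳ_) e) (sym (f-right j))))))
  glue : IsInjective y → IsInjective z → IsInjective f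
  glue iy iz k l e with splitAt-view {b} {c} k | splitAt-view {b} {c} l
  ... | inj₁ (i , refl) | inj₁ (j , refl) =
    cong (_↑ˡ c) (iy i j (↑ˡ-injective c _ _ (trans (sym (f-left i)) (trans e (f-left j)))))
  ... | inj₂ (i , refl) | inj₂ (j , refl) =
    cong (b ↑ʳ_) (iz i j (↑ʳ-injective b _ _ (trans (sym (f-right i)) (trans e (f-right j)))))
  ... | inj₁ (i , refl) | inj₂ (j , refl) =
    ⊥-elim (↑ˡ≢↑ʳ (y i) (z j) (trans (sym (f-left i)) (trans e (f-right j))))
  ... | inj₂ (i , refl) | inj₁ (j , refl) =
    ⊥-elim (↑ˡ≢↑ʳ (y j) (z i) (trans (sym (f-left j)) (trans (sym e) (f-right i))))

-- The permanent of a block diagonal matrix diag(B, C) is per B · per C: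
-- a map hitting an off-diagonal block contributes 0, so σ = y ++ z with
-- y, z mapping each block to itself.
per′-blockDiag : ∀ b c (M : Mat (b +ℕ c)) (B : Mat b) (C : Mat c) →
  (∀ i j → M (i ↑ˡ c) (j ↑ˡ c) ≡ B i j) → (∀ i j → M (b ↑ʳ i) (b ↑ʳ j) ≡ C i j) →
  (∀ i j → M (i ↑ˡ c) (b ↑ʳ j) ≡ + 0) → (∀ i j → M (b ↑ʳ i) (j ↑ˡ c) ≡ + 0) →
  per′ M ≡ per′ B * per′ C
per′-blockDiag b c M B C M≡B M≡C upper≡0 lower≡0 = begin
    per′ M
  ≡⟨ ∑maps-split b c N (per-term M) (per-term-ext M) ⟩
    ∑maps b N (λ y → ∑maps c N (λ z → per-term M (y ++ᶠ z)))
  ≡⟨ ∑maps-cong b N (λ y → ∑maps-cong c N (λ z → split-term y z)) ⟩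
    ∑maps b N (λ y → ∑maps c N (λ z → T y z))
  ≡⟨ ∑maps-cong b N (λ y →
       ∑maps-restrict c N c (b ↑ʳ_) InLeft onlyRight (T y) (T-extʳ y) (lower-vanishes y)) ⟩
    ∑maps b N (λ y → ∑maps c c (λ z → T y (right z)))
  ≡⟨ ∑maps-restrict b N b (_↑ˡ c) InRight onlyLeft _ Tʳ-ext upper-vanishes ⟩
    ∑maps b b (λ y → ∑maps c c (λ z → T (left y) (right z)))
  ≡⟨ ∑maps-cong b b (λ y → ∑maps-cong c c (λ z → diagonal-term y z)) ⟩
    ∑maps b b (λ y → ∑maps c c (λ z → per-term B y * per-term C z))
  ≡⟨ ∑maps-cong b b (λ y → ∑maps-*ˡ c c (per-term B y) (per-term C)) ⟩
    ∑maps b b (λ y → per-term B y * per′ C)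
  ≡⟨ ∑maps-*ʳ b b (per′ C) (per-term B) ⟩
    per′ B * per′ C
  ∎
  where
  open ≡-Reasoning
  N = b +ℕ c
  left : (Fin b → Fin b) → Fin b → Fin N
  left y i = y i ↑ˡ c
  right : (Fin c → Fin c) → Fin c → Fin N
  right z i = b ↑ʳ z i
  T : (Fin b → Fin N) → (Fin c → Fin N) → ℤ
  T y z = χ (y ++ᶠ z) * (∏ b (λ i → M (i ↑ˡ c) (y i)) * ∏ c (λ i → M (b ↑ʳ i) (z i)))
  split-term : ∀ y z → per-term M (y ++ᶠ z) ≡ T y z
  split-term y z = cong (χ (y ++ᶠ z) *_) (trans (∏-split b c _)
    (cong₂ _*_ (∏-cong b (λ i → cong (M (i ↑ˡ c)) (lookup-++ˡ y z i)))
               (∏-cong c (λ i → cong (M (b ↑ʳ i)) (lookup-++ʳ y z i)))))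
  T-ext : ∀ y y′ z z′ → (∀ i → y i ≡ y′ i) → (∀ i → z i ≡ z′ i) → T y z ≡ T y′ z′
  T-ext y y′ z z′ y≗y′ z≗z′ = cong₂ _*_ (χ-ext _ _ (++-cong y y′ y≗y′ z≗z′))
    (cong₂ _*_ (∏-cong b (λ i → cong (M (i ↑ˡ c)) (y≗y′ i))) (∏-cong c (λ i → cong (M (b ↑ʳ i)) (z≗z′ i))))
  T-extʳ : ∀ y → Extensional (T y)
  T-extʳ y z z′ = T-ext y y z z′ (λ _ → refl)
  Tʳ-ext : Extensional (λ y → ∑maps c c (λ z → T y (right z)))
  Tʳ-ext y y′ y≗y′ = ∑maps-cong c c (λ z → T-ext y y′ _ _ y≗y′ (λ _ → refl))
  InLeft InRight : Fin N → Set
  InLeft  x = ∃ λ x′ → x ≡ x′ ↑ˡ c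
  InRight x = ∃ λ x′ → x ≡ b ↑ʳ x′
  onlyRight : ∀ g → (∀ x → InLeft x → g x ≡ + 0) → ∑ N g ≡ ∑ c (λ w → g (b ↑ʳ w))
  onlyRight g g≡0 = ∑-right b c g (λ i → g≡0 _ (i , refl))
  onlyLeft : ∀ g → (∀ x → InRight x → g x ≡ + 0) → ∑ N g ≡ ∑ b (λ w → g (w ↑ˡ c))
  onlyLeft g g≡0 = ∑-left b c g (λ i → g≡0 _ (i , refl))
  -- A value of z in the first block, or of y in the second, picks an
  -- entry of an off-diagonal block.
  lower-vanishes : ∀ y z i → InLeft (z i) → T y z ≡ + 0
  lower-vanishes y z i (x′ , e) = begin
      T y z
    ≡⟨ cong (λ t → χ (y ++ᶠ z) * (∏ b (λ i → M (i ↑ˡ c) (y i)) * t))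
         (∏-zero c _ i (trans (cong (M (b ↑ʳ i)) e) (lower≡0 i x′))) ⟩
      χ (y ++ᶠ z) * (∏ b (λ i → M (i ↑ˡ c) (y i)) * + 0)
    ≡⟨ cong (χ (y ++ᶠ z) *_) (ℤP.*-zeroʳ (∏ b (λ i → M (i ↑ˡ c) (y i)))) ⟩
      χ (y ++ᶠ z) * + 0
    ≡⟨ ℤP.*-zeroʳ (χ (y ++ᶠ z)) ⟩
      + 0
    ∎
  upper-vanishes : ∀ y i → InRight (y i) → ∑maps c c (λ z → T y (right z)) ≡ + 0
  upper-vanishes y i (x′ , e) = ∑maps-zero c c (λ z → begin
      T y (right z)
    ≡⟨ cong (λ t → χ (y ++ᶠ right z) * (t * ∏ c (λ i → M (b ↑ʳ i) (right z i))))
         (∏-zero b _ i (trans (cong (M (i ↑ˡ c)) e) (upper≡0 i x′))) ⟩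
      χ (y ++ᶠ right z) * (+ 0 * ∏ c (λ i → M (b ↑ʳ i) (right z i)))
    ≡⟨ ℤP.*-zeroʳ (χ (y ++ᶠ right z)) ⟩
      + 0
    ∎)
  diagonal-term : ∀ y z → T (left y) (right z) ≡ per-term B y * per-term C z
  diagonal-term y z =
    trans (cong₂ _*_ (χ-blockMap y z)
                     (cong₂ _*_ (∏-cong b (λ i → M≡B i (y i))) (∏-cong c (λ i → M≡C i (z i)))))
          (interchange (χ y) (χ z) _ _)

-- Kronecker products

⊗-combine : ∀ {a b} (A : Mat a) (B : Mat b) i₁ i₂ j₁ j₂ →
  (A ⊗ B) (combine i₁ i₂) (combine j₁ j₂) ≡ A i₁ j₁ * B i₂ j₂
⊗-combine {a} {b} A B i₁ i₂ j₁ j₂ =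
  cong₂ (λ p q → A (proj₁ p) (proj₁ q) * B (proj₂ p) (proj₂ q))
        (remQuot-combine {a} {b} i₁ i₂) (remQuot-combine {a} {b} j₁ j₂)

combine-elim : ∀ {a b} (P : Fin (a *ℕ b) → Set) → (∀ i₁ i₂ → P (combine i₁ i₂)) → ∀ i → P i
combine-elim {a} {b} P h i with combine-surjective {a} {b} i
... | i₁ , i₂ , refl = h i₁ i₂

idMat-diag : ∀ n (i : Fin n) → idMat n i i ≡ + 1
idMat-diag n i with i ≟F i
... | yes _  = refl
... | no i≢i = ⊥-elim (i≢i refl)

idMat-offdiag : ∀ n (i j : Fin n) → ¬ i ≡ j → idMat n i j ≡ + 0
idMat-offdiag n i j i≢j with i ≟F j
... | yes i≡j = ⊥-elim (i≢j i≡j)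
... | no _    = refl

idMat-suc : ∀ n (i j : Fin n) → idMat (suc n) (suc i) (suc j) ≡ idMat n i j
idMat-suc n i j with i ≟F j
... | yes refl = refl
... | no _     = refl

-- I_{a+1} ⊗ B = diag(B, I_a ⊗ B), hence per(I_a ⊗ B) = per(B)^a.
per′-id⊗ : ∀ a b (B : Mat b) → per′ (idMat a ⊗ B) ≡ per′ B ^ℤ a
per′-id⊗ zero    b B = refl
per′-id⊗ (suc a) b B =
  trans (per′-blockDiag b (a *ℕ b) M B (idMat a ⊗ B) first-block rest-block upper lower)
        (cong (per′ B *_) (per′-id⊗ a b B))
  where
  M = idMat (suc a) ⊗ B
  first-block : ∀ i j → M (i ↑ˡ (a *ℕ b)) (j ↑ˡ (a *ℕ b)) ≡ B i j
  first-block i j = trans (⊗-combine (idMat (suc a)) B zero i zero j) (ℤP.*-identityˡ (B i j))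
  rest-block : ∀ i j → M (b ↑ʳ i) (b ↑ʳ j) ≡ (idMat a ⊗ B) i j
  rest-block = combine-elim _ (λ i₁ i₂ → combine-elim _ (λ j₁ j₂ →
    trans (⊗-combine (idMat (suc a)) B (suc i₁) i₂ (suc j₁) j₂)
      (trans (cong (_* B i₂ j₂) (idMat-suc a i₁ j₁)) (sym (⊗-combine (idMat a) B i₁ i₂ j₁ j₂)))))
  upper : ∀ i j → M (i ↑ˡ (a *ℕ b)) (b ↑ʳ j) ≡ + 0
  upper i = combine-elim _ (λ j₁ j₂ → ⊗-combine (idMat (suc a)) B zero i (suc j₁) j₂)
  lower : ∀ i j → M (b ↑ʳ i) (j ↑ˡ (a *ℕ b)) ≡ + 0
  lower = combine-elim _ (λ i₁ i₂ j → ⊗-combine (idMat (suc a)) B (suc i₁) i₂ zero j)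

-- The perfect shuffle combine i₁ i₂ ↦ combine i₂ i₁, conjugating A ⊗ B to B ⊗ A.
⊗-swap : ∀ a b → Permutation (a *ℕ b) (b *ℕ a)
⊗-swap a b = Perm.permutation (swap′ {a} {b}) (swap′ {b} {a}) (involutive {b} {a}) (involutive {a} {b})
  where
  swap′ : ∀ {m n} → Fin (m *ℕ n) → Fin (n *ℕ m)
  swap′ {m} {n} i = combine (proj₂ (remQuot {m} n i)) (proj₁ (remQuot {m} n i))
  swap′-combine : ∀ {m n} (i₁ : Fin m) (i₂ : Fin n) → swap′ {m} {n} (combine i₁ i₂) ≡ combine i₂ i₁
  swap′-combine {m} {n} i₁ i₂ = cong (λ p → combine (proj₂ p) (proj₁ p)) (remQuot-combine {m} {n} i₁ i₂)
  involutive : ∀ {m n} (i : Fin (m *ℕ n)) → swap′ {n} {m} (swap′ {m} {n} i) ≡ i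
  involutive {m} {n} = combine-elim {m} {n} _ (λ i₁ i₂ →
    trans (cong (swap′ {n} {m}) (swap′-combine i₁ i₂)) (swap′-combine i₂ i₁))

-- per(A ⊗ I_b) = per(A)^b: shuffling indices turns A ⊗ I_b into I_b ⊗ A.
per′-⊗id : ∀ a b (A : Mat a) → per′ (A ⊗ idMat b) ≡ per′ A ^ℤ b
per′-⊗id a b A = begin
    per′ (A ⊗ idMat b)
  ≡⟨ per′-cong _ _ shuffled ⟩
    per′ (λ i j → (idMat b ⊗ A) (τ ⟨$⟩ʳ i) (τ ⟨$⟩ʳ j))
  ≡⟨ per′-relabel-cast (ℕP.*-comm a b) τ (idMat b ⊗ A) ⟩
    per′ (idMat b ⊗ A)
  ≡⟨ per′-id⊗ b a A ⟩
    per′ A ^ℤ b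
  ∎
  where
  open ≡-Reasoning
  τ = ⊗-swap a b
  shuffled : ∀ i j → (A ⊗ idMat b) i j ≡ (idMat b ⊗ A) (τ ⟨$⟩ʳ i) (τ ⟨$⟩ʳ j)
  shuffled = combine-elim _ (λ i₁ i₂ → combine-elim _ (λ j₁ j₂ →
    trans (⊗-combine A (idMat b) i₁ i₂ j₁ j₂)
      (trans (ℤP.*-comm (A i₁ j₁) _)
        (trans (sym (⊗-combine (idMat b) A i₂ i₁ j₂ j₁))
          (cong₂ (λ p q → (idMat b ⊗ A) (combine (proj₂ p) (proj₁ p)) (combine (proj₂ q) (proj₁ q)))
                 (sym (remQuot-combine {a} {b} i₁ i₂)) (sym (remQuot-combine {a} {b} j₁ j₂)))))))

-- Mixed product rule, entrywise: (A ⊗ I)(I ⊗ B) = A ⊗ B.  In the sum over k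
-- only k = combine j₁ i₂ survives.
mixed-product : ∀ {a b} (A : Mat a) (B : Mat b) i₁ i₂ j₁ j₂ →
  ((A ⊗ idMat b) ·ₘ (idMat a ⊗ B)) (combine i₁ i₂) (combine j₁ j₂) ≡ A i₁ j₁ * B i₂ j₂
mixed-product {a} {b} A B i₁ i₂ j₁ j₂ =
  trans (Σᶠ≡∑ (a *ℕ b) term) (trans (∑-single (a *ℕ b) term k₀ off-k₀) at-k₀)
  where
  term : Fin (a *ℕ b) → ℤ
  term k = (A ⊗ idMat b) (combine i₁ i₂) k * (idMat a ⊗ B) k (combine j₁ j₂)
  k₀ = combine j₁ i₂
  term-combine : ∀ k₁ k₂ → term (combine k₁ k₂) ≡ (A i₁ k₁ * idMat b i₂ k₂) * (idMat a k₁ j₁ * B k₂ j₂)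
  term-combine k₁ k₂ = cong₂ _*_ (⊗-combine A (idMat b) i₁ i₂ k₁ k₂) (⊗-combine (idMat a) B k₁ k₂ j₁ j₂)
  vanish : ∀ k₁ k₂ → ¬ combine k₁ k₂ ≡ k₀ → Dec (i₂ ≡ k₂) → Dec (k₁ ≡ j₁) →
    (A i₁ k₁ * idMat b i₂ k₂) * (idMat a k₁ j₁ * B k₂ j₂) ≡ + 0
  vanish k₁ k₂ k≢k₀ (yes refl) (yes refl) = ⊥-elim (k≢k₀ refl)
  vanish k₁ k₂ k≢k₀ (no i₂≢k₂) _ rewrite idMat-offdiag b i₂ k₂ i₂≢k₂ | ℤP.*-zeroʳ (A i₁ k₁) = refl
  vanish k₁ k₂ k≢k₀ (yes _) (no k₁≢j₁) rewrite idMat-offdiag a k₁ j₁ k₁≢j₁ =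
    ℤP.*-zeroʳ (A i₁ k₁ * idMat b i₂ k₂)
  off-k₀ : ∀ k → ¬ k ≡ k₀ → term k ≡ + 0
  off-k₀ = combine-elim _ (λ k₁ k₂ k≢k₀ →
    trans (term-combine k₁ k₂) (vanish k₁ k₂ k≢k₀ (i₂ ≟F k₂) (k₁ ≟F j₁)))
  at-k₀ : term k₀ ≡ A i₁ j₁ * B i₂ j₂
  at-k₀ rewrite term-combine j₁ i₂ | idMat-diag b i₂ | idMat-diag a j₁
              | ℤP.*-identityʳ (A i₁ j₁) | ℤP.*-identityˡ (B i₂ j₂) = refl

-- Sylvester matrices: H_{n+m} is H_n ⊗ H_m up to relabelling

2^-+ : ∀ n m → 2 ^ (n +ℕ m) ≡ 2 ^ n *ℕ 2 ^ m
2^-+ n m = ℕP.^-distribˡ-+-* 2 n m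

cast-combine-zero : ∀ m (i : Fin (2 ^ m)) → cast (2^-+ 0 m) i ≡ combine {1} {2 ^ m} zero i
cast-combine-zero m i = toℕ-injective (begin
  toℕ (cast (2^-+ 0 m) i)             ≡⟨ toℕ-cast (2^-+ 0 m) i ⟩
  toℕ i                               ≡⟨ cong (_+ℕ toℕ i) (sym (ℕP.*-zeroʳ (2 ^ m))) ⟩
  2 ^ m *ℕ 0 +ℕ toℕ i                 ≡⟨ sym (toℕ-combine {1} {2 ^ m} zero i) ⟩
  toℕ (combine {1} {2 ^ m} zero i)    ∎)
  where open ≡-Reasoning

cast-combine-suc : ∀ n m (i₁ : Fin 2) (i₂ : Fin (2 ^ (n +ℕ m))) (i₂₁ : Fin (2 ^ n)) (i₂₂ : Fin (2 ^ m)) →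
  combine i₂₁ i₂₂ ≡ cast (2^-+ n m) i₂ →
  cast (2^-+ (suc n) m) (combine {2} {2 ^ (n +ℕ m)} i₁ i₂) ≡ combine (combine {2} {2 ^ n} i₁ i₂₁) i₂₂
cast-combine-suc n m i₁ i₂ i₂₁ i₂₂ digits = toℕ-injective (begin
    toℕ (cast (2^-+ (suc n) m) (combine {2} {2 ^ (n +ℕ m)} i₁ i₂))
  ≡⟨ toℕ-cast (2^-+ (suc n) m) _ ⟩
    toℕ (combine {2} {2 ^ (n +ℕ m)} i₁ i₂)
  ≡⟨ toℕ-combine {2} {2 ^ (n +ℕ m)} i₁ i₂ ⟩
    2 ^ (n +ℕ m) *ℕ toℕ i₁ +ℕ toℕ i₂
  ≡⟨ cong₂ (λ p q → p *ℕ toℕ i₁ +ℕ q) (2^-+ n m)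
       (sym (trans (cong toℕ digits) (toℕ-cast (2^-+ n m) i₂))) ⟩
    (2 ^ n *ℕ 2 ^ m) *ℕ toℕ i₁ +ℕ toℕ (combine i₂₁ i₂₂)
  ≡⟨ cong ((2 ^ n *ℕ 2 ^ m) *ℕ toℕ i₁ +ℕ_) (toℕ-combine i₂₁ i₂₂) ⟩
    (2 ^ n *ℕ 2 ^ m) *ℕ toℕ i₁ +ℕ (2 ^ m *ℕ toℕ i₂₁ +ℕ toℕ i₂₂)
  ≡⟨ solve 5 (λ X Y a b c → (X :* Y) :* a :+ (Y :* b :+ c) := Y :* (X :* a :+ b) :+ c) refl
       (2 ^ n) (2 ^ m) (toℕ i₁) (toℕ i₂₁) (toℕ i₂₂) ⟩
    2 ^ m *ℕ (2 ^ n *ℕ toℕ i₁ +ℕ toℕ i₂₁) +ℕ toℕ i₂₂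
  ≡⟨ sym (cong (λ p → 2 ^ m *ℕ p +ℕ toℕ i₂₂) (toℕ-combine {2} {2 ^ n} i₁ i₂₁)) ⟩
    2 ^ m *ℕ toℕ (combine {2} {2 ^ n} i₁ i₂₁) +ℕ toℕ i₂₂
  ≡⟨ sym (toℕ-combine (combine {2} {2 ^ n} i₁ i₂₁) i₂₂) ⟩
    toℕ (combine (combine {2} {2 ^ n} i₁ i₂₁) i₂₂)
  ∎)
  where
  open ≡-Reasoning
  open +-*-Solver

-- H_{n+m} i j = (H_n ⊗ H_m)(cast i)(cast j), by induction on n using the
-- associativity of the Kronecker product.
hadamard-+ : ∀ n m (i j : Fin (2 ^ (n +ℕ m))) →
  hadamard (n +ℕ m) i j ≡ (hadamard n ⊗ hadamard m) (cast (2^-+ n m) i) (cast (2^-+ n m) j)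
hadamard-+ zero m i j = sym (begin
    (hadamard 0 ⊗ hadamard m) (cast (2^-+ 0 m) i) (cast (2^-+ 0 m) j)
  ≡⟨ cong₂ (hadamard 0 ⊗ hadamard m) (cast-combine-zero m i) (cast-combine-zero m j) ⟩
    (hadamard 0 ⊗ hadamard m) (combine {1} zero i) (combine {1} zero j)
  ≡⟨ ⊗-combine (hadamard 0) (hadamard m) zero i zero j ⟩
    + 1 * hadamard m i j
  ≡⟨ ℤP.*-identityˡ _ ⟩
    hadamard m i j
  ∎)
  where open ≡-Reasoning
hadamard-+ (suc n) m =
  combine-elim {2} _ (λ i₁ i₂ → combine-elim {2} _ (λ j₁ j₂ → digits i₁ i₂ j₁ j₂))
  where
  cast′  = cast (2^-+ n m)
  cast″ = cast (2^-+ (suc n) m)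
  digits : ∀ i₁ i₂ j₁ j₂ →
    hadamard (suc n +ℕ m) (combine i₁ i₂) (combine j₁ j₂)
      ≡ (hadamard (suc n) ⊗ hadamard m) (cast″ (combine i₁ i₂)) (cast″ (combine j₁ j₂))
  digits i₁ i₂ j₁ j₂
    with combine-surjective {2 ^ n} {2 ^ m} (cast′ i₂) | combine-surjective {2 ^ n} {2 ^ m} (cast′ j₂)
  ... | i₂₁ , i₂₂ , ei | j₂₁ , j₂₂ , ej = begin
      hadamard (suc n +ℕ m) (combine i₁ i₂) (combine j₁ j₂)
    ≡⟨ ⊗-combine H₂ (hadamard (n +ℕ m)) i₁ i₂ j₁ j₂ ⟩
      H₂ i₁ j₁ * hadamard (n +ℕ m) i₂ j₂
    ≡⟨ cong (H₂ i₁ j₁ *_) (hadamard-+ n m i₂ j₂) ⟩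
      H₂ i₁ j₁ * (hadamard n ⊗ hadamard m) (cast′ i₂) (cast′ j₂)
    ≡⟨ cong (H₂ i₁ j₁ *_) (cong₂ (hadamard n ⊗ hadamard m) (sym ei) (sym ej)) ⟩
      H₂ i₁ j₁ * (hadamard n ⊗ hadamard m) (combine i₂₁ i₂₂) (combine j₂₁ j₂₂)
    ≡⟨ cong (H₂ i₁ j₁ *_) (⊗-combine (hadamard n) (hadamard m) i₂₁ i₂₂ j₂₁ j₂₂) ⟩
      H₂ i₁ j₁ * (hadamard n i₂₁ j₂₁ * hadamard m i₂₂ j₂₂)
    ≡⟨ sym (ℤP.*-assoc (H₂ i₁ j₁) _ _) ⟩
      (H₂ i₁ j₁ * hadamard n i₂₁ j₂₁) * hadamard m i₂₂ j₂₂
    ≡⟨ cong (_* hadamard m i₂₂ j₂₂) (sym (⊗-combine H₂ (hadamard n) i₁ i₂₁ j₁ j₂₁)) ⟩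
      hadamard (suc n) (combine i₁ i₂₁) (combine j₁ j₂₁) * hadamard m i₂₂ j₂₂
    ≡⟨ sym (⊗-combine (hadamard (suc n)) (hadamard m) (combine i₁ i₂₁) i₂₂ (combine j₁ j₂₁) j₂₂) ⟩
      (hadamard (suc n) ⊗ hadamard m) (combine (combine i₁ i₂₁) i₂₂) (combine (combine j₁ j₂₁) j₂₂)
    ≡⟨ sym (cong₂ (hadamard (suc n) ⊗ hadamard m)
         (cast-combine-suc n m i₁ i₂ i₂₁ i₂₂ ei) (cast-combine-suc n m j₁ j₂ j₂₁ j₂₂ ej)) ⟩
      (hadamard (suc n) ⊗ hadamard m) (cast″ (combine i₁ i₂)) (cast″ (combine j₁ j₂))
    ∎ where open ≡-Reasoning

per′-hadamard-+ : ∀ n m → per′ (hadamard (n +ℕ m)) ≡ per′ (hadamard n ⊗ hadamard m)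
per′-hadamard-+ n m =
  trans (per′-cong _ _ (hadamard-+ n m))
        (per′-relabel-cast (2^-+ n m) (Perm.cast-id (2^-+ n m)) (hadamard n ⊗ hadamard m))

per′-mixed-product : ∀ n m →
  per′ ((hadamard n ⊗ idMat (2 ^ m)) ·ₘ (idMat (2 ^ n) ⊗ hadamard m)) ≡ per′ (hadamard (n +ℕ m))
per′-mixed-product n m = trans (per′-cong _ _ entries) (sym (per′-hadamard-+ n m))
  where
  entries : ∀ i j → ((hadamard n ⊗ idMat (2 ^ m)) ·ₘ (idMat (2 ^ n) ⊗ hadamard m)) i j
                    ≡ (hadamard n ⊗ hadamard m) i j
  entries = combine-elim _ (λ i₁ i₂ → combine-elim _ (λ j₁ j₂ →
    trans (mixed-product (hadamard n) (hadamard m) i₁ i₂ j₁ j₂)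
          (sym (⊗-combine (hadamard n) (hadamard m) i₁ i₂ j₁ j₂))))

per-⊗id : ∀ {a} (A : Mat a) b → per (A ⊗ idMat b) ≡ per A ^ℤ b
per-⊗id {a} A b = begin
  per (A ⊗ idMat b)   ≡⟨ per≡per′ (A ⊗ idMat b) ⟩
  per′ (A ⊗ idMat b)  ≡⟨ per′-⊗id a b A ⟩
  per′ A ^ℤ b         ≡⟨ cong (_^ℤ b) (sym (per≡per′ A)) ⟩
  per A ^ℤ b          ∎
  where open ≡-Reasoning

per-id⊗ : ∀ a {b} (B : Mat b) → per (idMat a ⊗ B) ≡ per B ^ℤ a
per-id⊗ a {b} B = begin
  per (idMat a ⊗ B)   ≡⟨ per≡per′ (idMat a ⊗ B) ⟩
  per′ (idMat a ⊗ B)  ≡⟨ per′-id⊗ a b B ⟩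
  per′ B ^ℤ a         ≡⟨ cong (_^ℤ a) (sym (per≡per′ B)) ⟩
  per B ^ℤ a          ∎
  where open ≡-Reasoning

per-mixed-product : ∀ n m →
  per ((hadamard n ⊗ idMat (2 ^ m)) ·ₘ (idMat (2 ^ n) ⊗ hadamard m)) ≡ per (hadamard (n +ℕ m))
per-mixed-product n m = begin
    per ((hadamard n ⊗ idMat (2 ^ m)) ·ₘ (idMat (2 ^ n) ⊗ hadamard m))
  ≡⟨ per≡per′ ((hadamard n ⊗ idMat (2 ^ m)) ·ₘ (idMat (2 ^ n) ⊗ hadamard m)) ⟩
    per′ ((hadamard n ⊗ idMat (2 ^ m)) ·ₘ (idMat (2 ^ n) ⊗ hadamard m))
  ≡⟨ per′-mixed-product n m ⟩
    per′ (hadamard (n +ℕ m))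
  ≡⟨ sym (per≡per′ (hadamard (n +ℕ m))) ⟩
    per (hadamard (n +ℕ m))
  ∎ where open ≡-Reasoning

-- Laplace expansion along the first row, used to evaluate small permanents

minor : ∀ {n} → Mat (suc n) → Fin (suc n) → Mat n
minor M v i j = M (suc i) (punchIn v j)

-- Permanent by cofactor expansion; unlike per, it is cheap to evaluate.
perLaplace : (n : ℕ) → Mat n → ℤ
perLaplace zero    M = + 1
perLaplace (suc n) M = Σᶠ (suc n) (λ v → M zero v * perLaplace n (minor M v))

-- per′ M = Σ_v M 0 v · per′(minor M v): an injective σ with σ 0 = v is
-- v followed by punchIn v ∘ τ for an injective τ.
per′-laplace : ∀ n (M : Mat (suc n)) → per′ M ≡ ∑ (suc n) (λ v → M zero v * per′ (minor M v))
per′-laplace n M = ∑-cong (suc n) (λ v →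
  trans (∑maps-restrict n (suc n) n (punchIn v) (_≡ v) (avoid v) (λ f → per-term M (v ∷ᶠ f))
           (Extensional-∷ (per-term-ext M) v) (repeated v))
    (trans (∑maps-cong n n (λ τ → expand v τ)) (∑maps-*ˡ n n (M zero v) _)))
  where
  avoid : ∀ v g → (∀ x → x ≡ v → g x ≡ + 0) → ∑ (suc n) g ≡ ∑ n (λ w → g (punchIn v w))
  avoid v g g≡0 = trans (∑-punchIn n g v)
    (trans (cong (_+ ∑ n (λ w → g (punchIn v w))) (g≡0 v refl)) (ℤP.+-identityˡ _))
  repeated : ∀ v f i → f i ≡ v → per-term M (v ∷ᶠ f) ≡ + 0
  repeated v f i fi≡v = cong (_* ∏ (suc n) (λ i → M i ((v ∷ᶠ f) i)))
    (χ-noninjective (v ∷ᶠ f) (λ inj → 0≢1+n (inj zero (suc i) (sym fi≡v))))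
  χ-punchIn : ∀ v (τ : Fin n → Fin n) → χ (v ∷ᶠ (punchIn v ∘ τ)) ≡ χ τ
  χ-punchIn v τ = χ-cong _ τ (λ inj i j e → suc-injective (inj (suc i) (suc j) (cong (punchIn v) e))) glue
    where
    glue : IsInjective τ → IsInjective (v ∷ᶠ (punchIn v ∘ τ))
    glue inj zero    zero    e = refl
    glue inj zero    (suc j) e = ⊥-elim (punchInᵢ≢i v (τ j) (sym e))
    glue inj (suc i) zero    e = ⊥-elim (punchInᵢ≢i v (τ i) e)
    glue inj (suc i) (suc j) e = cong suc (inj i j (punchIn-injective v _ _ e))
  expand : ∀ v (τ : Fin n → Fin n) →
    per-term M (v ∷ᶠ (punchIn v ∘ τ)) ≡ M zero v * per-term (minor M v) τ
  expand v τ = begin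
      χ (v ∷ᶠ (punchIn v ∘ τ)) * (M zero v * ∏ n (λ i → minor M v i (τ i)))
    ≡⟨ cong (_* (M zero v * ∏ n (λ i → minor M v i (τ i)))) (χ-punchIn v τ) ⟩
      χ τ * (M zero v * ∏ n (λ i → minor M v i (τ i)))
    ≡⟨ x∙yz≈y∙xz (χ τ) (M zero v) _ ⟩
      M zero v * (χ τ * ∏ n (λ i → minor M v i (τ i)))
    ∎ where open ≡-Reasoning

perLaplace≡per′ : ∀ n (M : Mat n) → perLaplace n M ≡ per′ M
perLaplace≡per′ zero    M = refl
perLaplace≡per′ (suc n) M =
  trans (Σᶠ≡∑ (suc n) (λ v → M zero v * perLaplace n (minor M v)))
    (trans (∑-cong (suc n) (λ v → cong (M zero v *_) (perLaplace≡per′ n (minor M v))))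
           (sym (per′-laplace n M)))

per-via-Laplace : ∀ {N} (M : Mat N) → per M ≡ perLaplace N M
per-via-Laplace {N} M = trans (per≡per′ M) (sym (perLaplace≡per′ N M))

-- The values are computed once here, by evaluation; abstract keeps the type
-- checker from ever unfolding these proofs (and so re-evaluating them) later.
abstract
  per-hadamard-2 : per (hadamard 2) ≡ + 8
  per-hadamard-2 = per-via-Laplace (hadamard 2)

  per-hadamard-3 : per (hadamard 3) ≡ + 384
  per-hadamard-3 = per-via-Laplace (hadamard 3)

IsPositive : ℤ → Set
IsPositive x = Σ ℕ (λ n → x ≡ + suc n)

*-positive : ∀ x y → IsPositive x → IsPositive y → IsPositive (x * y)
*-positive x y (a , refl) (b , refl) = _ , refl

^-positive : ∀ x t → IsPositive x → IsPositive (x ^ℤ t)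
^-positive x zero    x>0 = 0 , refl
^-positive x (suc t) x>0 = *-positive x (x ^ℤ t) x>0 (^-positive x t x>0)

square-positive : ∀ y → ¬ y ≡ + 0 → IsPositive (y * y)
square-positive (+ zero)  y≢0 = ⊥-elim (y≢0 refl)
square-positive (+ suc n) y≢0 = _ , refl
square-positive -[1+ n ]  y≢0 = _ , refl

fourth-power-positive : ∀ y → ¬ y ≡ + 0 → IsPositive (y ^ℤ 4)
fourth-power-positive y y≢0 = subst IsPositive y²y²≡y⁴
  (*-positive _ _ (square-positive y y≢0) (square-positive y y≢0))
  where
  y²y²≡y⁴ : (y * y) * (y * y) ≡ y ^ℤ 4
  y²y²≡y⁴ = trans (ℤP.*-assoc y y (y * y)) (cong (λ t → y * (y * (y * t))) (sym (ℤP.*-identityʳ y)))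

positive⇒≢0 : ∀ x → IsPositive x → ¬ x ≡ + 0
positive⇒≢0 x (a , refl) ()

positive-≤⇒≢0 : ∀ x y → IsPositive x → x ≤ y → ¬ y ≡ + 0
positive-≤⇒≢0 x y (a , refl) (+≤+ ()) refl

ProductInequality : Set
ProductInequality = (n m : ℕ) → 2 ≤ℕ n → 2 ≤ℕ m →
  per (hadamard n ⊗ idMat (2 ^ m)) * per (idMat (2 ^ n) ⊗ hadamard m)
    ≤ per ((hadamard n ⊗ idMat (2 ^ m)) ·ₘ (idMat (2 ^ n) ⊗ hadamard m))

per-hadamard-lower-bound : ProductInequality → ∀ m → 2 ≤ℕ m →
  (+ 8) ^ℤ (2 ^ m) * per (hadamard m) ^ℤ 4 ≤ per (hadamard (2 +ℕ m))
per-hadamard-lower-bound hyp m 2≤m =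
  subst₂ _≤_ (cong₂ _*_ factor-H₂ (per-id⊗ (2 ^ 2) (hadamard m))) (per-mixed-product 2 m)
         (hyp 2 m (s≤s (s≤s z≤n)) 2≤m)
  where
  factor-H₂ : per (hadamard 2 ⊗ idMat (2 ^ m)) ≡ (+ 8) ^ℤ (2 ^ m)
  factor-H₂ = trans (per-⊗id (hadamard 2) (2 ^ m)) (cong (_^ℤ (2 ^ m)) per-hadamard-2)

-- Transport along k ≡ k₀ for a literal k₀.  (Matching k against a literal
-- directly yields a goal that is not syntactically the one of
-- per-hadamard-3, and the type checker then evaluates both permanents.)
per-hadamard≢0-at : ∀ {k₀} k → k ≡ k₀ → ¬ per (hadamard k₀) ≡ + 0 → ¬ per (hadamard k) ≡ + 0
per-hadamard≢0-at k refl per≢0 = per≢0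

per-hadamard≢0 : ProductInequality → ∀ k → 2 ≤ℕ k → ¬ per (hadamard k) ≡ + 0
per-hadamard≢0 hyp zero          ()
per-hadamard≢0 hyp (suc zero)    (s≤s ())
per-hadamard≢0 hyp k@(suc (suc zero)) _ =
  per-hadamard≢0-at {2} k refl (positive⇒≢0 (per (hadamard 2)) (7 , per-hadamard-2))
per-hadamard≢0 hyp k@(suc (suc (suc zero))) _ =
  per-hadamard≢0-at {3} k refl (positive⇒≢0 (per (hadamard 3)) (383 , per-hadamard-3))
per-hadamard≢0 hyp (suc (suc m@(suc (suc _)))) _ =
  positive-≤⇒≢0 _ _
    (*-positive _ _ (^-positive (+ 8) (2 ^ m) (7 , refl))
                    (fourth-power-positive _ (per-hadamard≢0 hyp m 2≤m)))
    (per-hadamard-lower-bound hyp m 2≤m)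
  where
  2≤m : 2 ≤ℕ m
  2≤m = s≤s (s≤s z≤n)

proposition1 :
    ((n m : ℕ) → 2 ≤ℕ n → 2 ≤ℕ m →
      per (hadamard n ⊗ idMat (2 ^ m)) * per (idMat (2 ^ n) ⊗ hadamard m)
        ≤ per ((hadamard n ⊗ idMat (2 ^ m)) ·ₘ (idMat (2 ^ n) ⊗ hadamard m))) →
    (k : ℕ) → 2 <ℕ k → per (hadamard k) ≢ + 0
proposition1 hyp k 2<k = per-hadamard≢0 hyp k (ℕP.<⇒≤ 2<k)
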